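{- Let $G$ be a connected graph and $v\in V(G)$ a vertex such that $G-v$ is connected. Then $\mathrm{adim}(G)\le\mathrm{adim}(G-v)+1$. Moreover, the bound is sharp: for every $n\ge 3$, $G=K_n$ and any vertex $v$ satisfy $\mathrm{adim}(G)=\mathrm{adim}(G-v)+1$.
   Context: All graphs are finite, simple and undirected; $G-v$ is the graph obtained by deleting $v$ and its incident edges, and $K_n$ is the complete graph on $n$ vertices. For vertices $x,y$, $d(x,y)$ is the length of a shortest $x$–$y$ path ($\infty$ if in different components) and $d_1(x,y)=\min\{d(x,y),2\}$. A set $S\subseteq V(G)$ is an adjacency resolving set of $G$ if for any two distinct $x,y\in V(G)$ there is $z\in S$ with $d_1(x,z)\neq d_1(y,z)$; $\mathrm{adim}(G)$ is the minimum cardinality of such a set. -}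

module Defs where

open import Data.Nat using (ℕ; zero; suc; _≤_)
open import Data.Fin using (Fin; punchIn)
open import Data.Fin.Subset using (Subset; _∈_; ∣_∣)
open import Data.Bool using (Bool; true; false)
open import Data.Product using (Σ; ∃; _×_; _,_)
open import Relation.Binary.PropositionalEquality using (_≡_; _≢_)
open import Relation.Binary.Construct.Closure.ReflexiveTransitive using (Star)
open import Relation.Nullary using (¬_; Dec; yes; no)
open import Data.Fin using (_≟_)

record Graph (n : ℕ) : Set where
  field
    adj   : Fin n → Fin n → Bool
    adj-sym : ∀ x y → adj x y ≡ adj y x
    irrefl : ∀ x → adj x x ≡ false
open Graph public

Adj : ∀ {n} → Graph n → Fin n → Fin n → Set
Adj G x y = adj G x y ≡ true

Connected : ∀ {n} → Graph n → Set
Connected {n} G = ∀ (x y : Fin n) → Star (Adj G) x y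

-- G - v : delete v; the remaining vertices are re-indexed by Fin n via punchIn v
delete : ∀ {n} → Graph (suc n) → Fin (suc n) → Graph n
delete G v = record
  { adj = λ i j → adj G (punchIn v i) (punchIn v j)
  ; adj-sym = λ i j → adj-sym G (punchIn v i) (punchIn v j)
  ; irrefl = λ i → irrefl G (punchIn v i) }

complete : (n : ℕ) → Graph n
complete n = record
  { adj = λ x y → isNo (x ≟ y)
  ; adj-sym = λ x y → symLemma x y
  ; irrefl = λ x → irrLemma x }
  where
  isNo : ∀ {A : Set} → Dec A → Bool
  isNo (yes _) = false
  isNo (no _)  = true
  open import Relation.Binary.PropositionalEquality using (refl; sym)
  open import Data.Empty using (⊥-elim)
  symLemma : ∀ x y → isNo (x ≟ y) ≡ isNo (y ≟ x)
  symLemma x y with x ≟ y | y ≟ x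
  ... | yes _ | yes _ = refl
  ... | no _  | no _  = refl
  ... | yes p | no q  = ⊥-elim (q (sym p))
  ... | no p  | yes q = ⊥-elim (p (sym q))
  irrLemma : ∀ x → isNo (x ≟ x) ≡ false
  irrLemma x with x ≟ x
  ... | yes _ = refl
  ... | no p  = ⊥-elim (p refl)

-- Truncated distance d₁(x,y) = min{d(x,y), 2}: it is 0 iff x = y,
-- 1 iff x,y adjacent, and 2 otherwise (distance ≥ 2 or ∞).
-- We express it as a relation "d₁(x,y) = k".
data D₁ {n} (G : Graph n) (x y : Fin n) : ℕ → Set where
  d-zero : x ≡ y → D₁ G x y 0
  d-one  : Adj G x y → D₁ G x y 1
  d-two  : x ≢ y → ¬ Adj G x y → D₁ G x y 2

Distinguishes : ∀ {n} → Graph n → Fin n → Fin n → Fin n → Set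
Distinguishes G z x y = ∀ k → D₁ G x z k → ¬ D₁ G y z k

IsAdjResolving : ∀ {n} → Graph n → Subset n → Set
IsAdjResolving {n} G S =
  ∀ (x y : Fin n) → x ≢ y → ∃ λ z → z ∈ S × Distinguishes G z x y

IsAdim : ∀ {n} → Graph n → ℕ → Set
IsAdim {n} G k =
  (∃ λ (S : Subset n) → IsAdjResolving G S × ∣ S ∣ ≡ k)
  × (∀ (S : Subset n) → IsAdjResolving G S → k ≤ ∣ S ∣)

module Submission where

-- Let S be an adjacency resolving set of G - v and let
-- S⁺ be S transported to G (through punchIn v) together with v itself.
-- Any vertex distinguishes itself from every other vertex, so pairs
-- containing v are resolved by v; any other pair is the image of a pair
-- of G - v, resolved by some z ∈ S, and since deleting v changes neither
-- equality nor adjacency among the remaining vertices, punchIn v z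
-- resolves the pair in G.  Hence adim G ≤ ∣ S⁺ ∣ = adim (G - v) + 1.
--
-- In a graph where all distinct vertices are adjacent, a
-- vertex outside {x, y} is adjacent to both, so it cannot resolve x, y:
-- the resolving sets are exactly the sets meeting every pair of distinct
-- vertices.  On k + 1 vertices such a set misses at most one vertex, so
-- it has at least k elements, and "all but one vertex" attains k.  Thus
-- adim K_{k+1} = k; as K_{m+1} - v is again complete on m vertices, the
-- two dimensions are m and m - 1 (here m ≥ 1 is needed).

open import Defs
open import Data.Nat using (ℕ; suc; _≤_; _+_; _∸_)
open import Data.Nat.Properties using (≤-trans; ≤-antisym; ≤-reflexive; +-comm; n≤1+n)
open import Data.Fin using (Fin; punchIn; punchOut; _≟_)
import Data.Fin as Fin
open import Data.Fin.Properties using (punchIn-injective; punchIn-punchOut; all?; ¬∀⟶∃¬)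
open import Data.Fin.Subset using (Subset; inside; outside; _∈_; _⊆_; ∣_∣; ⊤; ∁; ⁅_⁆)
open import Data.Fin.Subset.Properties
  using (_∈?_; ∣⊤∣≡n; ∣∁p∣≡n∸∣p∣; ∣⁅x⁆∣≡1; p⊆q⇒∣p∣≤∣q∣;
         x≢y⇒x∉⁅y⁆; x∉p⇒x∈∁p; x∈∁p⇒x∉p; x∈⁅x⁆)
open import Data.Vec using (insertAt; _∷_)
open import Data.Vec.Properties using (insertAt-lookup; insertAt-punchIn; []=⇒lookup; lookup⇒[]=)
open import Data.Product using (_×_; _,_; ∃)
open import Data.Sum using (_⊎_; inj₁; inj₂)
open import Relation.Nullary using (yes; no; contradiction)
open import Relation.Binary.PropositionalEquality
  using (_≡_; _≢_; refl; sym; trans; cong; subst; subst₂)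

-- A vertex distinguishes itself from any other vertex: d₁(x,x) = 0,
-- while d₁(y,x) ≠ 0 for y ≠ x.
distinguishes-self-left : ∀ {n} (G : Graph n) {x y : Fin n} →
  x ≢ y → Distinguishes G x x y
distinguishes-self-left G x≢y _ (d-zero _)   (d-zero y≡x) = x≢y (sym y≡x)
distinguishes-self-left G x≢y _ (d-one xx)   _            =
  contradiction (trans (sym xx) (irrefl G _)) λ ()
distinguishes-self-left G x≢y _ (d-two x≢x _) _           = x≢x refl

distinguishes-self-right : ∀ {n} (G : Graph n) {x y : Fin n} →
  x ≢ y → Distinguishes G y x y
distinguishes-self-right G x≢y k d₁x d₁y =
  distinguishes-self-left G (λ y≡x → x≢y (sym y≡x)) k d₁y d₁x

Covers : ∀ {n} → Subset n → Set
Covers {n} S = ∀ (x y : Fin n) → x ≢ y → x ∈ S ⊎ y ∈ S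

covers⇒resolving : ∀ {n} (G : Graph n) {S : Subset n} →
  Covers S → IsAdjResolving G S
covers⇒resolving G cov x y x≢y with cov x y x≢y
... | inj₁ x∈S = x , x∈S , distinguishes-self-left G x≢y
... | inj₂ y∈S = y , y∈S , distinguishes-self-right G x≢y

-- The truncated distance between surviving vertices is the same in G and
-- in G - v: deletion preserves equality (punchIn is injective) and adjacency.
D₁-delete : ∀ {n} (G : Graph (suc n)) (v : Fin (suc n)) {x z : Fin n} {k : ℕ} →
  D₁ G (punchIn v x) (punchIn v z) k → D₁ (delete G v) x z k
D₁-delete G v (d-zero x≡z)    = d-zero (punchIn-injective v _ _ x≡z)
D₁-delete G v (d-one  xz)     = d-one xz
D₁-delete G v (d-two  x≢z ¬xz) = d-two (λ x≡z → x≢z (cong (punchIn v) x≡z)) ¬xz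

distinguishes-lift : ∀ {n} (G : Graph (suc n)) (v : Fin (suc n)) {z x y : Fin n} →
  Distinguishes (delete G v) z x y →
  Distinguishes G (punchIn v z) (punchIn v x) (punchIn v y)
distinguishes-lift G v dist k d₁x d₁y = dist k (D₁-delete G v d₁x) (D₁-delete G v d₁y)

-- The subset of Fin (suc n) consisting of v and the image of S under punchIn v.
extend : ∀ {n} → Fin (suc n) → Subset n → Subset (suc n)
extend v S = insertAt S v inside

-- Membership and size of extend v S, read off from the library facts
-- about insertAt: position v holds inside, position punchIn v z holds S z.
∈-extend-self : ∀ {n} (v : Fin (suc n)) (S : Subset n) → v ∈ extend v S
∈-extend-self v S = lookup⇒[]= v _ (insertAt-lookup S v inside)

∈-extend-punchIn : ∀ {n} (v : Fin (suc n)) (S : Subset n) {z : Fin n} →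
  z ∈ S → punchIn v z ∈ extend v S
∈-extend-punchIn v S z∈S =
  lookup⇒[]= _ _ (trans (insertAt-punchIn S v inside _) ([]=⇒lookup z∈S))

∣extend∣ : ∀ {n} (v : Fin (suc n)) (S : Subset n) → ∣ extend v S ∣ ≡ suc ∣ S ∣
∣extend∣ Fin.zero    S              = refl
∣extend∣ (Fin.suc v) (inside  ∷ S)  = cong suc (∣extend∣ v S)
∣extend∣ (Fin.suc v) (outside ∷ S)  = ∣extend∣ v S

extend-resolving : ∀ {n} (G : Graph (suc n)) (v : Fin (suc n)) {S : Subset n} →
  IsAdjResolving (delete G v) S → IsAdjResolving G (extend v S)
extend-resolving G v {S} res x y x≢y with v ≟ x | v ≟ y
... | yes refl | _        = v , ∈-extend-self v S , distinguishes-self-left G x≢y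
... | no _     | yes refl = v , ∈-extend-self v S , distinguishes-self-right G x≢y
... | no v≢x   | no v≢y   =
  subst₂ (λ x y → ∃ λ z → z ∈ extend v S × Distinguishes G z x y)
    (punchIn-punchOut v≢x) (punchIn-punchOut v≢y)
    (lifted (λ x′≡y′ → x≢y (pullback x′≡y′)))
  where
  x′ y′ : Fin _
  x′ = punchOut v≢x
  y′ = punchOut v≢y
  pullback : x′ ≡ y′ → x ≡ y
  pullback x′≡y′ = trans (sym (punchIn-punchOut v≢x))
                    (trans (cong (punchIn v) x′≡y′) (punchIn-punchOut v≢y))
  lifted : x′ ≢ y′ →
    ∃ λ z → z ∈ extend v S × Distinguishes G z (punchIn v x′) (punchIn v y′)
  lifted x′≢y′ with res x′ y′ x′≢y′
  ... | z , z∈S , dist =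
    punchIn v z , ∈-extend-punchIn v S z∈S , distinguishes-lift G v dist

adim-delete-bound : ∀ {n} (G : Graph (suc n)) (v : Fin (suc n)) {a b : ℕ} →
  IsAdim G a → IsAdim (delete G v) b → a ≤ b + 1
adim-delete-bound G v {b = b} (_ , minimal) ((S , res , ∣S∣≡b) , _) =
  ≤-trans (minimal (extend v S) (extend-resolving G v res))
          (≤-reflexive (trans (∣extend∣ v S) (trans (cong suc ∣S∣≡b) (+-comm 1 b))))

IsComplete : ∀ {n} → Graph n → Set
IsComplete {n} G = ∀ (x y : Fin n) → x ≢ y → Adj G x y

complete-isComplete : ∀ n → IsComplete (complete n)
complete-isComplete n x y x≢y with x ≟ y
... | yes x≡y = contradiction x≡y x≢y
... | no _    = refl

delete-isComplete : ∀ {n} (G : Graph (suc n)) (v : Fin (suc n)) →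
  IsComplete G → IsComplete (delete G v)
delete-isComplete G v compl x y x≢y =
  compl (punchIn v x) (punchIn v y) (λ e → x≢y (punchIn-injective v x y e))

-- In a complete graph a third vertex z is adjacent to both x and y, so
-- d₁(x,z) = d₁(y,z) = 1: only x or y itself can resolve the pair.
resolving⇒covers : ∀ {n} (G : Graph n) {S : Subset n} →
  IsComplete G → IsAdjResolving G S → Covers S
resolving⇒covers G compl res x y x≢y with res x y x≢y
... | z , z∈S , dist with z ≟ x | z ≟ y
...   | yes refl | _        = inj₁ z∈S
...   | no _     | yes refl = inj₂ z∈S
...   | no z≢x   | no z≢y   =
  contradiction (d-one (compl y z (λ e → z≢y (sym e))))
                (dist 1 (d-one (compl x z (λ e → z≢x (sym e)))))

allBut : ∀ {n} → Fin n → Subset n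
allBut x = ∁ ⁅ x ⁆

∈-allBut : ∀ {n} {x y : Fin n} → y ≢ x → y ∈ allBut x
∈-allBut y≢x = x∉p⇒x∈∁p (x≢y⇒x∉⁅y⁆ y≢x)

∣allBut∣ : ∀ {k} (x : Fin (suc k)) → ∣ allBut x ∣ ≡ k
∣allBut∣ {k} x = trans (∣∁p∣≡n∸∣p∣ ⁅ x ⁆) (cong (suc k ∸_) (∣⁅x⁆∣≡1 x))

allBut-covers : ∀ {n} (x : Fin n) → Covers (allBut x)
allBut-covers x y z y≢z with y ≟ x
... | no  y≢x = inj₁ (∈-allBut y≢x)
... | yes refl = inj₂ (∈-allBut (λ z≡y → y≢z (sym z≡y)))

-- A covering set of Fin (suc k) has at least k elements: either it is
-- everything, or it misses some x and then contains all vertices but x.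
covers-size : ∀ {k} (S : Subset (suc k)) → Covers S → k ≤ ∣ S ∣
covers-size {k} S cov with all? (_∈? S)
... | yes all∈S = ≤-trans (n≤1+n k)
                    (subst (_≤ ∣ S ∣) (∣⊤∣≡n (suc k)) (p⊆q⇒∣p∣≤∣q∣ {p = ⊤} (λ {y} _ → all∈S y)))
... | no ¬all∈S with ¬∀⟶∃¬ (suc k) (_∈ S) (_∈? S) ¬all∈S
...   | x , x∉S = subst (_≤ ∣ S ∣) (∣allBut∣ x) (p⊆q⇒∣p∣≤∣q∣ allBut⊆S)
  where
  allBut⊆S : allBut x ⊆ S
  allBut⊆S {y} y∈allBut with y ≟ x
  ... | yes refl = contradiction (x∈⁅x⁆ x) (x∈∁p⇒x∉p y∈allBut)
  ... | no y≢x with cov y x y≢x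
  ...   | inj₁ y∈S = y∈S
  ...   | inj₂ x∈S = contradiction x∈S x∉S

adim-complete : ∀ {k} (G : Graph (suc k)) → IsComplete G → ∀ {a} → IsAdim G a → a ≡ k
adim-complete {k} G compl ((S , res , ∣S∣≡a) , minimal) =
  ≤-antisym
    (subst (_ ≤_) (∣allBut∣ Fin.zero)
      (minimal (allBut Fin.zero) (covers⇒resolving G (allBut-covers Fin.zero))))
    (subst (k ≤_) ∣S∣≡a (covers-size S (resolving⇒covers G compl res)))

proposition6p3 :
    ((n : ℕ) (G : Graph (suc n)) (v : Fin (suc n)) →
      Connected G → Connected (delete G v) →
      (a b : ℕ) → IsAdim G a → IsAdim (delete G v) b → a ≤ b + 1)
    ×
    ((m : ℕ) → 2 ≤ m → (v : Fin (suc m)) →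
      (a b : ℕ) → IsAdim (complete (suc m)) a → IsAdim (delete (complete (suc m)) v) b →
      a ≡ b + 1)
proposition6p3 = upper-bound , sharpness
  where
  upper-bound : (n : ℕ) (G : Graph (suc n)) (v : Fin (suc n)) →
    Connected G → Connected (delete G v) →
    (a b : ℕ) → IsAdim G a → IsAdim (delete G v) b → a ≤ b + 1
  upper-bound n G v _ _ a b = adim-delete-bound G v

  sharpness : (m : ℕ) → 2 ≤ m → (v : Fin (suc m)) →
    (a b : ℕ) → IsAdim (complete (suc m)) a → IsAdim (delete (complete (suc m)) v) b →
    a ≡ b + 1
  sharpness (suc m) _ v a b adimK adimK-v =
    trans (adim-complete K (complete-isComplete (suc (suc m))) adimK)
          (trans (cong suc (sym (adim-complete (delete K v) K-v-complete adimK-v)))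
                 (+-comm 1 b))
    where
    K : Graph (suc (suc m))
    K = complete (suc (suc m))
    K-v-complete : IsComplete (delete K v)
    K-v-complete = delete-isComplete K v (complete-isComplete (suc (suc m)))
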